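{- Let $Q$ be a generalized quantifier of type $\langle n_1,\ldots,n_k\rangle$ where the arities are pairwise distinct, i.e. $n_i \neq n_j$ whenever $i\neq j$. If $Q$ is implicitly definable in $L_2(\mathsf{Q})$ (in the sense below, with Henkin semantics), then $Q$ is definable in first-order logic: there is a first-order sentence $\varphi$ in the vocabulary consisting of relation symbols $P_1,\ldots,P_k$ of arities $n_1,\ldots,n_k$ such that for every nonempty set $M$ and all $R_1\subseteq M^{n_1},\ldots,R_k\subseteq M^{n_k}$, $$(M,R_1,\ldots,R_k)\models\varphi \iff \langle R_1,\ldots,R_k\rangle\in Q_M.$$
   Context: A generalized quantifier $Q$ of type $\langle n_1,\ldots,n_k\rangle$ is a class function assigning to each set $M$ a set $Q_M\subseteq \mathcal P(M^{n_1})\times\cdots\times\mathcal P(M^{n_k})$. The language $L_2$ is pure second-order logic: it has individual variables $x,y,z,\ldots$ and predicate variables $P,P_1,P_2,\ldots$ of each arity (including $0$-ary); atomic formulas are predicate variables applied to individual variables (e.g. $P(x,y)$); formulas are built from atomic formulas with $\lnot,\lor,\land,\to$ and quantifiers $\forall,\exists$ over both individual variables and predicate variables. There are no other non-logical symbols (no equality symbol assumed beyond this). Henkin semantics: an $L_2$ model $\mathcal M$ consists of a set $M$ (the range of individual variables) together with, for each $k\ge 0$, a completely arbitrary set $\mathrm{Pred}_k(\mathcal M)\subseteq\mathcal P(M^k)$ over which $k$-ary predicate variables range (no comprehension or other closure conditions are imposed). The language $L_2(\mathsf Q)$ is $L_2$ extended by a second-order predicate symbol $\mathsf Q$ of type $\langle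 n_1,\ldots,n_k\rangle$: if $X_1,\ldots,X_k$ are predicate variables of arities $n_1,\ldots,n_k$, then $\mathsf Q(X_1,\ldots,X_k)$ is an atomic formula. A model of $L_2(\mathsf Q)$ is an $L_2$ model $\mathcal M$ together with an interpretation of $\mathsf Q$ as a second-order predicate over $\mathcal M$, i.e. a subset of $\mathrm{Pred}_{n_1}(\mathcal M)\times\cdots\times\mathrm{Pred}_{n_k}(\mathcal M)$. A generalized quantifier $Q$ induces on each $L_2$ model $\mathcal M$ the second-order predicate $Q_{\mathcal M}=Q_M\cap\bigl(\mathrm{Pred}_{n_1}(\mathcal M)\times\cdots\times\mathrm{Pred}_{n_k}(\mathcal M)\bigr)$. A sentence $\sigma$ of $L_2(\mathsf Q)$ implicitly defines $Q$ if for every $L_2$ model $\mathcal M$, the only second-order predicate over $\mathcal M$ which, as interpretation of $\mathsf Q$, makes $\sigma$ true in $\mathcal M$ is $Q_{\mathcal M}$. $Q$ is implicitly definable in $L_2(\mathsf Q)$ if some such sentence exists. -}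

module Defs where

open import Level using (Level; 0ℓ; Lift) renaming (suc to lsuc)
open import Data.Nat using (ℕ; zero; suc)
open import Data.Fin using (Fin; zero; suc)
open import Data.Vec using (Vec; []; _∷_; lookup; map)
open import Data.List using (List; []; _∷_)
open import Data.List.Membership.Propositional using (_∈_)
open import Data.List.Relation.Unary.All as All using (All; []; _∷_)
open import Data.Product using (Σ; _×_; _,_)
open import Data.Sum using (_⊎_)
open import Relation.Nullary using (¬_)
open import Relation.Binary.PropositionalEquality using (_≡_)

_↔_ : ∀ {a b} → Set a → Set b → Set _
A ↔ B = (A → B) × (B → A)

Rel : Set → ℕ → Set₁
Rel M j = Vec M j → Set

-- Extensional equality of subsets (= equality of the sets they denote).
_≐_ : ∀ {M j} → Rel M j → Rel M j → Set
X ≐ Y = ∀ v → X v ↔ Y v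

module _ {k : ℕ} (n : Fin k → ℕ) where

  Args : Set → Set₁
  Args M = (i : Fin k) → Rel M (n i)

  _≐ₐ_ : ∀ {M} → Args M → Args M → Set
  X ≐ₐ Y = ∀ i → X i ≐ Y i

  GQ : Set₁
  GQ = (M : Set) → Args M → Set

  -- Q_M is a set of tuples of *sets*: membership respects extensional equality.
  IsExtensionalGQ : GQ → Set₁
  IsExtensionalGQ Q = ∀ M (X Y : Args M) → X ≐ₐ Y → Q M X → Q M Y

  -- Henkin models of L₂: domain M and arbitrary collections Pred_j ⊆ P(M^j)
  -- (closure under ≐ only says Pred_j is a set of sets).
  record HenkinModel : Set₁ where
    field
      Dom    : Set
      Pr     : (j : ℕ) → Rel Dom j → Set
      Pr-ext : ∀ j (X Y : Rel Dom j) → X ≐ Y → Pr j X → Pr j Y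
  open HenkinModel public

  SOPred : HenkinModel → Set₁
  SOPred 𝓜 = Args (Dom 𝓜) → Set

  -- I is a subset of Pred_{n_1}(𝓜) × ⋯ × Pred_{n_k}(𝓜) (a set of tuples of sets).
  IsInterp : (𝓜 : HenkinModel) → SOPred 𝓜 → Set₁
  IsInterp 𝓜 I =
    (∀ X → I X → ∀ i → Pr 𝓜 (n i) (X i)) ×
    (∀ X Y → X ≐ₐ Y → I X → I Y)

  Q𝓜 : GQ → (𝓜 : HenkinModel) → SOPred 𝓜
  Q𝓜 Q 𝓜 X = Q (Dom 𝓜) X × (∀ i → Pr 𝓜 (n i) (X i))

  -- Syntax of L₂(𝖰): m individual variables (de Bruijn), Γ = arities of
  -- the predicate variables in scope (de Bruijn, via membership proofs).
  data L2Q (m : ℕ) (Γ : List ℕ) : Set where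
    atom  : ∀ {j} → j ∈ Γ → Vec (Fin m) j → L2Q m Γ
    qatom : ((i : Fin k) → n i ∈ Γ) → L2Q m Γ
    neg   : L2Q m Γ → L2Q m Γ
    _or_  : L2Q m Γ → L2Q m Γ → L2Q m Γ
    _and_ : L2Q m Γ → L2Q m Γ → L2Q m Γ
    _imp_ : L2Q m Γ → L2Q m Γ → L2Q m Γ
    all₁  : L2Q (suc m) Γ → L2Q m Γ
    ex₁   : L2Q (suc m) Γ → L2Q m Γ
    all₂  : (j : ℕ) → L2Q m (j ∷ Γ) → L2Q m Γ
    ex₂   : (j : ℕ) → L2Q m (j ∷ Γ) → L2Q m Γ

  sat : (𝓜 : HenkinModel) (I : SOPred 𝓜) {m : ℕ} {Γ : List ℕ} →
        L2Q m Γ → Vec (Dom 𝓜) m → All (Rel (Dom 𝓜)) Γ → Set₁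
  sat 𝓜 I (atom p xs) ρ σ = Lift (lsuc 0ℓ) (All.lookup σ p (map (lookup ρ) xs))
  sat 𝓜 I (qatom ps)  ρ σ = Lift (lsuc 0ℓ) (I (λ i → All.lookup σ (ps i)))
  sat 𝓜 I (neg φ)     ρ σ = ¬ sat 𝓜 I φ ρ σ
  sat 𝓜 I (φ or ψ)    ρ σ = sat 𝓜 I φ ρ σ ⊎ sat 𝓜 I ψ ρ σ
  sat 𝓜 I (φ and ψ)   ρ σ = sat 𝓜 I φ ρ σ × sat 𝓜 I ψ ρ σ
  sat 𝓜 I (φ imp ψ)   ρ σ = sat 𝓜 I φ ρ σ → sat 𝓜 I ψ ρ σ
  sat 𝓜 I (all₁ φ)    ρ σ = (a : Dom 𝓜) → sat 𝓜 I φ (a ∷ ρ) σ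
  sat 𝓜 I (ex₁ φ)     ρ σ = Σ (Dom 𝓜) λ a → sat 𝓜 I φ (a ∷ ρ) σ
  sat 𝓜 I (all₂ j φ)  ρ σ = (X : Rel (Dom 𝓜) j) → Pr 𝓜 j X → sat 𝓜 I φ ρ (X ∷ σ)
  sat 𝓜 I (ex₂ j φ)   ρ σ = Σ (Rel (Dom 𝓜) j) λ X → Pr 𝓜 j X × sat 𝓜 I φ ρ (X ∷ σ)

  ImplicitlyDefines : GQ → L2Q 0 [] → Set₁
  ImplicitlyDefines Q σ =
    (𝓜 : HenkinModel) →
      sat 𝓜 (Q𝓜 Q 𝓜) σ [] [] ×
      ((I : SOPred 𝓜) → IsInterp 𝓜 I → sat 𝓜 I σ [] [] →
        ∀ X → I X ↔ Q𝓜 Q 𝓜 X)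

  ImplicitlyDefinable : GQ → Set₁
  ImplicitlyDefinable Q = Σ (L2Q 0 []) (ImplicitlyDefines Q)

  data FO (m : ℕ) : Set where
    rel   : (i : Fin k) → Vec (Fin m) (n i) → FO m
    eq    : Fin m → Fin m → FO m
    neg   : FO m → FO m
    _or_  : FO m → FO m → FO m
    _and_ : FO m → FO m → FO m
    _imp_ : FO m → FO m → FO m
    all   : FO (suc m) → FO m
    ex    : FO (suc m) → FO m

  fosat : (M : Set) → Args M → {m : ℕ} → FO m → Vec M m → Set
  fosat M R (rel i xs) ρ = R i (map (lookup ρ) xs)
  fosat M R (eq x y)   ρ = lookup ρ x ≡ lookup ρ y
  fosat M R (neg φ)    ρ = ¬ fosat M R φ ρ
  fosat M R (φ or ψ)   ρ = fosat M R φ ρ ⊎ fosat M R ψ ρ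
  fosat M R (φ and ψ)  ρ = fosat M R φ ρ × fosat M R ψ ρ
  fosat M R (φ imp ψ)  ρ = fosat M R φ ρ → fosat M R ψ ρ
  fosat M R (all φ)    ρ = (a : M) → fosat M R φ (a ∷ ρ)
  fosat M R (ex φ)     ρ = Σ M λ a → fosat M R φ (a ∷ ρ)

  FODefinable : GQ → Set₁
  FODefinable Q =
    Σ (FO 0) λ φ → (M : Set) → M → (R : Args M) → fosat M R φ [] ↔ Q M R

module Submission where

-- Fix M and R = (R_1,…,R_k) with R_i ⊆ M^{n_i}.  Let 𝓜_R be the
-- Henkin model on M whose j-ary predicate variables range only over those R_i
-- with n_i = j.  Since the arities are pairwise distinct, Pred_j(𝓜_R) has at most
-- one element, so 𝓜_R carries a single candidate tuple for 𝖰, namely R itself;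
-- an interpretation I of 𝖰 either contains R ("full") or is empty.
--
-- This lets us translate any L₂(𝖰) formula into first-order logic over P_1,…,P_k
-- uniformly in M and R: a predicate variable of arity j becomes the unique P_i
-- with n_i = j, a quantifier over such a variable disappears (it has exactly one
-- value), a quantifier over an arity not in the type becomes ⊤ / ⊥, and 𝖰(…)
-- becomes ⊤.  The translation lemma says that in 𝓜_R, under any full
-- interpretation of 𝖰, the formula and its translation agree.
--
-- For the implicit definition σ of Q, its translation φ defines Q: if R ∈ Q_M then
-- Q_{𝓜_R} is full and satisfies σ, so (M,R) ⊨ φ; conversely if (M,R) ⊨ φ then
-- the full interpretation satisfies σ, hence equals Q_{𝓜_R} and contains R.
-- The argument is constructive and does not use that M is nonempty.

open import Defs
open import Level using (Level; 0ℓ; lift; lower) renaming (suc to lsuc)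
open import Axiom.ExcludedMiddle using (ExcludedMiddle)
open import Data.Nat using (ℕ; _≟_)
open import Data.Nat.Properties using (≡-irrelevant)
open import Data.Fin using (Fin; zero)
open import Data.Fin.Properties using (any?)
open import Data.Vec using (Vec; []; _∷_; map; lookup)
open import Data.List.Membership.Propositional using (_∈_)
open import Data.List.Relation.Unary.Any using (here; there)
open import Data.List.Relation.Unary.All as All using (All; []; _∷_)
open import Data.Product using (Σ; _×_; _,_; proj₁; proj₂; map₂)
open import Data.Sum using (_⊎_; inj₁; inj₂; [_,_]′)
import Data.Sum as Sum
import Data.Product as Prod
open import Data.Empty using (⊥-elim)
open import Relation.Nullary using (¬_; yes; no)
open import Relation.Binary.PropositionalEquality using (_≡_; refl; sym; trans; subst)
open import Function.Definitions using (Injective)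

private variable
  a b : Level
  A B C D : Set a

↔-neg : A ↔ B → (¬ A) ↔ (¬ B)
↔-neg (f , g) = (λ ¬a b → ¬a (g b)) , (λ ¬b a → ¬b (f a))

↔-⊎ : A ↔ B → C ↔ D → (A ⊎ C) ↔ (B ⊎ D)
↔-⊎ (f , g) (h , k) = Sum.map f h , Sum.map g k

↔-× : A ↔ B → C ↔ D → (A × C) ↔ (B × D)
↔-× (f , g) (h , k) = Prod.map f h , Prod.map g k

↔-→ : A ↔ B → C ↔ D → (A → C) ↔ (B → D)
↔-→ (f , g) (h , k) = (λ u b → h (u (g b))) , (λ v a → k (v (f a)))

module _ {x : Level} {X : Set x} {B : X → Set a} {C : X → Set b} where

  ↔-Π : (∀ y → B y ↔ C y) → ((y : X) → B y) ↔ ((y : X) → C y)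
  ↔-Π e = (λ u y → proj₁ (e y) (u y)) , (λ v y → proj₂ (e y) (v y))

  ↔-Σ : (∀ y → B y ↔ C y) → Σ X B ↔ Σ X C
  ↔-Σ e = (λ { (y , u) → y , proj₁ (e y) u }) , (λ { (y , v) → y , proj₂ (e y) v })

-- A quantifier bounded by P, when P has a witness x₀ and the body is equivalent
-- to A on all of P, is equivalent to A.  (Used for predicate quantifiers ranging
-- over a singleton Pred_j.)
module _ {x p : Level} {X : Set x} {P : X → Set p} {B : X → Set b}
         (x₀ : X) (P₀ : P x₀) (e : ∀ y → P y → A ↔ B y) where

  ↔-bounded-∀ : A ↔ ((y : X) → P y → B y)
  ↔-bounded-∀ = (λ u y py → proj₁ (e y py) u) , (λ v → proj₂ (e x₀ P₀) (v x₀ P₀))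

  ↔-bounded-∃ : A ↔ Σ X (λ y → P y × B y)
  ↔-bounded-∃ = (λ u → x₀ , P₀ , proj₁ (e x₀ P₀) u)
              , (λ { (y , py , v) → proj₂ (e y py) v })

module _ {M : Set} {j : ℕ} where

  ≐-refl : (X : Rel M j) → X ≐ X
  ≐-refl X v = (λ x → x) , (λ x → x)

  ≐-sym : {X Y : Rel M j} → X ≐ Y → Y ≐ X
  ≐-sym e v = proj₂ (e v) , proj₁ (e v)

  ≐-trans : {X Y Z : Rel M j} → X ≐ Y → Y ≐ Z → X ≐ Z
  ≐-trans e f v = (λ x → proj₁ (f v) (proj₁ (e v) x)) , (λ z → proj₂ (e v) (proj₂ (f v) z))

module _ {k : ℕ} (n : Fin k → ℕ) where

  Idx : ℕ → Set
  Idx j = Σ (Fin k) λ i → n i ≡ j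

  findIdx : (j : ℕ) → Idx j ⊎ ¬ Idx j
  findIdx j with any? (λ i → n i ≟ j)
  ... | yes a = inj₁ a
  ... | no ¬a = inj₂ ¬a

  Idx-unique : Injective _≡_ _≡_ n → ∀ {j} (a b : Idx j) → a ≡ b
  Idx-unique inj (i , e) (i' , e') with inj (trans e (sym e'))
  ... | refl with ≡-irrelevant e e'
  ... | refl = refl

  -- First-order truth and falsity (available without constants or nonemptiness).
  ⊤FO : ∀ {m} → FO n m
  ⊤FO = all (eq zero zero)

  ⊥FO : ∀ {m} → FO n m
  ⊥FO = neg ⊤FO

  relAt : ∀ {m j} → Idx j → Vec (Fin m) j → FO n m
  relAt (i , refl) xs = rel i xs

  translate : ∀ {m Γ} → L2Q n m Γ → All Idx Γ → FO n m
  translate (atom p xs) τ = relAt (All.lookup τ p) xs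
  translate (qatom ps)  τ = ⊤FO
  translate (neg φ)     τ = neg (translate φ τ)
  translate (φ or ψ)    τ = translate φ τ or translate ψ τ
  translate (φ and ψ)   τ = translate φ τ and translate ψ τ
  translate (φ imp ψ)   τ = translate φ τ imp translate ψ τ
  translate (all₁ φ)    τ = all (translate φ τ)
  translate (ex₁ φ)     τ = ex (translate φ τ)
  translate (all₂ j φ)  τ = [ (λ a → translate φ (a ∷ τ)) , (λ _ → ⊤FO) ]′ (findIdx j)
  translate (ex₂ j φ)   τ = [ (λ a → translate φ (a ∷ τ)) , (λ _ → ⊥FO) ]′ (findIdx j)

  module ModelOf (M : Set) (R : Args n M) where

    Rat : ∀ {j} → Idx j → Rel M j
    Rat (i , refl) = R i

    PredR : (j : ℕ) → Rel M j → Set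
    PredR j X = Σ (Idx j) λ a → X ≐ Rat a

    𝓜R : HenkinModel n
    𝓜R = record { Dom = M ; Pr = PredR
                ; Pr-ext = λ j X Y e → map₂ (≐-trans (≐-sym e)) }

    relAt-meaning : ∀ {m j} (a : Idx j) (xs : Vec (Fin m) j) (ρ : Vec M m) →
                    fosat n M R (relAt a xs) ρ ≡ Rat a (map (lookup ρ) xs)
    relAt-meaning (i , refl) xs ρ = refl

    AllPred : SOPred n 𝓜R
    AllPred X = ∀ i → PredR (n i) (X i)

    Full : SOPred n 𝓜R → Set₁
    Full I = ∀ X → AllPred X → I X

    AllPred-isInterp : IsInterp n 𝓜R AllPred
    AllPred-isInterp = (λ X h → h) , (λ X Y e h i → Pr-ext 𝓜R (n i) (X i) (Y i) (e i) (h i))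

    R-AllPred : AllPred R
    R-AllPred i = (i , refl) , ≐-refl (R i)

    Matches : ∀ {Γ} → All Idx Γ → All (Rel M) Γ → Set
    Matches {Γ} τ σ = ∀ {j} (p : j ∈ Γ) → All.lookup σ p ≐ Rat (All.lookup τ p)

    Matches-[] : Matches [] []
    Matches-[] ()

    Matches-∷ : ∀ {j Γ} {τ : All Idx Γ} {σ : All (Rel M) Γ} (a : Idx j) {X : Rel M j} →
                X ≐ Rat a → Matches τ σ → Matches (a ∷ τ) (X ∷ σ)
    Matches-∷ a e c (here refl) = e
    Matches-∷ a e c (there p)   = c p

    module _ (inj : Injective _≡_ _≡_ n) where

      PredR-singleton : ∀ {j} (a : Idx j) {X : Rel M j} → PredR j X → X ≐ Rat a
      PredR-singleton a (b , e) = subst (λ c → _ ≐ Rat c) (Idx-unique inj b a) e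

      AllPred-is-R : ∀ X → AllPred X → _≐ₐ_ n X R
      AllPred-is-R X h i = PredR-singleton (i , refl) (h i)

      translate-correct : (I : SOPred n 𝓜R) → Full I →
        ∀ {m Γ} (φ : L2Q n m Γ) (τ : All Idx Γ) (σ : All (Rel M) Γ) → Matches τ σ →
        (ρ : Vec M m) → fosat n M R (translate φ τ) ρ ↔ sat n 𝓜R I φ ρ σ
      translate-correct I full = go
        where
        go : ∀ {m Γ} (φ : L2Q n m Γ) (τ : All Idx Γ) (σ : All (Rel M) Γ) → Matches τ σ →
             (ρ : Vec M m) → fosat n M R (translate φ τ) ρ ↔ sat n 𝓜R I φ ρ σ
        go (atom p xs) τ σ c ρ rewrite relAt-meaning (All.lookup τ p) xs ρ =
          (λ r → lift (proj₂ (c p _) r)) , (λ s → proj₁ (c p _) (lower s))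
        go (qatom ps) τ σ c ρ =
          (λ _ → lift (full _ (λ i → All.lookup τ (ps i) , c (ps i)))) , (λ _ a → refl)
        go (neg φ)   τ σ c ρ = ↔-neg (go φ τ σ c ρ)
        go (φ or ψ)  τ σ c ρ = ↔-⊎ (go φ τ σ c ρ) (go ψ τ σ c ρ)
        go (φ and ψ) τ σ c ρ = ↔-× (go φ τ σ c ρ) (go ψ τ σ c ρ)
        go (φ imp ψ) τ σ c ρ = ↔-→ (go φ τ σ c ρ) (go ψ τ σ c ρ)
        go (all₁ φ)  τ σ c ρ = ↔-Π λ x → go φ τ σ c (x ∷ ρ)
        go (ex₁ φ)   τ σ c ρ = ↔-Σ λ x → go φ τ σ c (x ∷ ρ)
        go (all₂ j φ) τ σ c ρ with findIdx j
        ... | inj₁ a = ↔-bounded-∀ (Rat a) (a , ≐-refl _)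
                         λ X pX → go φ (a ∷ τ) (X ∷ σ) (Matches-∷ a (PredR-singleton a pX) c) ρ
        ... | inj₂ ¬a = (λ _ X pX → ⊥-elim (¬a (proj₁ pX))) , (λ _ x → refl)
        go (ex₂ j φ) τ σ c ρ with findIdx j
        ... | inj₁ a = ↔-bounded-∃ (Rat a) (a , ≐-refl _)
                         λ X pX → go φ (a ∷ τ) (X ∷ σ) (Matches-∷ a (PredR-singleton a pX) c) ρ
        ... | inj₂ ¬a = (λ ¬⊤ → ⊥-elim (¬⊤ λ x → refl))
                      , (λ { (X , pX , _) → ⊥-elim (¬a (proj₁ pX)) })

mainTheorem1 : ExcludedMiddle (lsuc 0ℓ) →
    (k : ℕ) (n : Fin k → ℕ) → Injective _≡_ _≡_ n →
    (Q : GQ n) → IsExtensionalGQ n Q →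
    ImplicitlyDefinable n Q → FODefinable n Q
mainTheorem1 _ k n inj Q Q-ext (σ , defines) = translate n σ [] , λ M _ R → defines-at M R
  where
  defines-at : (M : Set) (R : Args n M) → fosat n M R (translate n σ []) [] ↔ Q M R
  defines-at M R = to , from
    where
    open ModelOf n M R
    σ↔ : (I : SOPred n 𝓜R) → Full I → fosat n M R (translate n σ []) [] ↔ sat n 𝓜R I σ [] []
    σ↔ I full = translate-correct inj I full σ [] [] Matches-[] []

    -- Q_{𝓜_R} is full as soon as R ∈ Q_M, since every predicate tuple of 𝓜_R is R.
    Q𝓜R-full : Q M R → Full (Q𝓜 n Q 𝓜R)
    Q𝓜R-full q X h = Q-ext M R X (λ i → ≐-sym (AllPred-is-R inj X h i)) q , h

    -- The full interpretation satisfying σ must be Q_{𝓜_R}, which then contains R.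
    to : fosat n M R (translate n σ []) [] → Q M R
    to φ-holds = proj₁ (proj₁ (proj₂ (defines 𝓜R) AllPred AllPred-isInterp
                   (proj₁ (σ↔ AllPred (λ X h → h)) φ-holds) R) R-AllPred)

    from : Q M R → fosat n M R (translate n σ []) []
    from q = proj₂ (σ↔ (Q𝓜 n Q 𝓜R) (Q𝓜R-full q)) (proj₁ (defines 𝓜R))
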